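{- Let $n\ge1$. For every homogeneous polynomial $w\in\mathbb{Z}\langle \mathbf{a},\mathbf{b}\rangle$ of degree $n-1$, $$\Theta(w)=(1-q)^n\cdot[n]!\cdot \mathrm{ps}^*(\gamma(w)).$$ In particular, for every graded poset $P$ of rank $n$, $\Theta(\Psi(P))=(1-q)^n\cdot[n]!\cdot\mathrm{ps}^*(F(P))$.
   Context: $\mathbb{Z}\langle \mathbf{a},\mathbf{b}\rangle$ is the ring of polynomials in non-commuting variables $\mathbf{a},\mathbf{b}$. The Major MacMahon map $\Theta:\mathbb{Z}\langle \mathbf{a},\mathbf{b}\rangle\to\mathbb{Z}[q]$ is linear with $\Theta(u_1\cdots u_m)=\prod_{i:\,u_i=\mathbf{b}}q^i$ on monomials. For a composition $\alpha=(\alpha_1,\dots,\alpha_k)$ of $n$ (positive integers summing to $n$), let $v_\alpha=(\mathbf{a}-\mathbf{b})^{\alpha_1-1}\mathbf{b}(\mathbf{a}-\mathbf{b})^{\alpha_2-1}\mathbf{b}\cdots\mathbf{b}(\mathbf{a}-\mathbf{b})^{\alpha_k-1}$, of degree $n-1$, and let $M_\alpha=\sum_{i_1<\dots<i_k}t_{i_1}^{\alpha_1}\cdots t_{i_k}^{\alpha_k}$ be the monomial quasi-symmetric function. $\gamma$ is the linear map from $\mathbb{Z}\langle \mathbf{a},\mathbf{b}\rangle$ to quasi-symmetric functions with $\gamma(v_\alpha)=M_\alpha$ for all compositions $\alpha$ of $n\ge1$. The stable principal specialization is $\mathrm{ps}(f)=f(1,q,q^2,\dots)$; the reversal $*$ is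 the linear map with $M_\alpha^*=M_{\alpha^*}$ where $\alpha^*=(\alpha_k,\dots,\alpha_1)$; and $\mathrm{ps}^*(f)=\mathrm{ps}(f^*)$. For a graded poset $P$ of rank $n$ (minimum $\hat0$, maximum $\hat1$, rank $\rho$), its $\mathbf{a}\mathbf{b}$-index is $\Psi(P)=\sum_{S\subseteq\{1,\dots,n-1\}}f_Sv_S$, where $f_S$ counts chains $\hat0<x_1<\dots<x_k<\hat1$ with $\{\rho(x_i)\}=S$ and $v_S=v_1\cdots v_{n-1}$ with $v_i=\mathbf{b}$ if $i\in S$, $\mathbf{a}-\mathbf{b}$ otherwise; its quasi-symmetric function is $F(P)=\gamma(\Psi(P))$. $[k]=1+q+\dots+q^{k-1}$, $[n]!=[n]\cdots[1]$. -}

module Defs where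

open import Data.Nat using (ℕ; zero; suc; _+_; _*_; _∸_; _≡ᵇ_; _≤ᵇ_)
open import Data.Integer using (ℤ; +_; -_) renaming (_+_ to _+ℤ_; _*_ to _*ℤ_)
open import Data.Bool using (Bool; true; false; if_then_else_; _∧_)
open import Data.List using (List; []; _∷_; map; foldr; concatMap; upTo; reverse; allFin; _++_; length)
open import Data.Vec using (Vec; []; _∷_)
open import Data.Fin using (Fin)
open import Data.Product using (_×_; _,_)
open import Relation.Nullary using (¬_; Dec; yes; no)
open import Relation.Binary.PropositionalEquality using (_≡_; _≢_)

sumℤ : List ℤ → ℤ
sumℤ = foldr _+ℤ_ (+ 0)

sumℕ : List ℕ → ℕ
sumℕ = foldr _+_ 0

-- Formal power series in q over ℤ (polynomials are the finitely
-- supported ones); equality is coefficientwise.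

Series : Set
Series = ℕ → ℤ

_⊛_ : Series → Series → Series
(f ⊛ g) N = sumℤ (map (λ i → f i *ℤ g (N ∸ i)) (upTo (suc N)))

infixl 7 _⊛_

oneS : Series
oneS zero = + 1
oneS (suc _) = + 0

oneMinusQ : Series
oneMinusQ zero = + 1
oneMinusQ (suc zero) = - (+ 1)
oneMinusQ (suc (suc _)) = + 0

powS : Series → ℕ → Series
powS f zero = oneS
powS f (suc k) = f ⊛ powS f k

qint : ℕ → Series
qint k N = if suc N ≤ᵇ k then + 1 else + 0

qfact : ℕ → Series
qfact zero = oneS
qfact (suc k) = qint (suc k) ⊛ qfact k

-- Non-commutative polynomials Z<a,b>: formal Z-linear combinations of
-- words in {a,b}; a word is a List Bool with false = a, true = b.
-- Equality is equality of all coefficients.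

Word : Set
Word = List Bool

NCPoly : Set
NCPoly = List (ℤ × Word)

eqBool : Bool → Bool → Bool
eqBool true true = true
eqBool false false = true
eqBool _ _ = false

eqWord : Word → Word → Bool
eqWord [] [] = true
eqWord (x ∷ u) (y ∷ v) = eqBool x y ∧ eqWord u v
eqWord _ _ = false

coeff : NCPoly → Word → ℤ
coeff p u = sumℤ (map (λ { (c , v) → if eqWord v u then c else + 0 }) p)

_≈P_ : NCPoly → NCPoly → Set
p ≈P r = ∀ u → coeff p u ≡ coeff r u

Homogeneous : ℕ → NCPoly → Set
Homogeneous d w = ∀ u → length u ≢ d → coeff w u ≡ + 0

_⊕_ : NCPoly → NCPoly → NCPoly
p ⊕ r = p ++ r

scale : ℤ → NCPoly → NCPoly
scale c p = map (λ { (d , u) → (c *ℤ d , u) }) p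

_⊗_ : NCPoly → NCPoly → NCPoly
p ⊗ r = concatMap (λ { (c , u) → map (λ { (d , v) → (c *ℤ d , u ++ v) }) r }) p

infixl 7 _⊗_
infixl 6 _⊕_

oneP : NCPoly
oneP = (+ 1 , []) ∷ []

𝐚 𝐛 : NCPoly
𝐚 = (+ 1 , false ∷ []) ∷ []
𝐛 = (+ 1 , true ∷ []) ∷ []

𝐜 : NCPoly
𝐜 = 𝐚 ⊕ scale (- (+ 1)) 𝐛

powP : NCPoly → ℕ → NCPoly
powP p zero = oneP
powP p (suc k) = p ⊗ powP p k

weightFrom : ℕ → Word → ℕ
weightFrom i [] = 0
weightFrom i (true ∷ u) = i + weightFrom (suc i) u
weightFrom i (false ∷ u) = weightFrom (suc i) u

-- Σ_{i : u_i = b} i  (positions 1-indexed)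
majWeight : Word → ℕ
majWeight = weightFrom 1

Θ : NCPoly → Series
Θ p N = sumℤ (map (λ { (c , u) → if majWeight u ≡ᵇ N then c else + 0 }) p)

vα : List ℕ → NCPoly
vα [] = oneP          -- not used: compositions are nonempty
vα (a ∷ []) = powP 𝐜 (a ∸ 1)
vα (a ∷ α@(_ ∷ _)) = powP 𝐜 (a ∸ 1) ⊗ 𝐛 ⊗ vα α

-- Compositions of n = suc m are indexed by subsets S ⊆ {1,…,m},
-- given as S : Vec Bool m (entry i, 1-indexed, is true iff i ∈ S);
-- comp S is the composition whose partial sums are the elements of S.
compFrom : {m : ℕ} → ℕ → Vec Bool m → List ℕ
compFrom acc [] = acc ∷ []
compFrom acc (true ∷ s) = acc ∷ compFrom 1 s
compFrom acc (false ∷ s) = compFrom (suc acc) s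

comp : {m : ℕ} → Vec Bool m → List ℕ
comp = compFrom 1

allVec : (m : ℕ) → List (Vec Bool m)
allVec zero = [] ∷ []
allVec (suc m) = map (false ∷_) (allVec m) ++ map (true ∷_) (allVec m)

ΣvBasis : (m : ℕ) → (Vec Bool m → ℤ) → NCPoly
ΣvBasis m c = concatMap (λ S → scale (c S) (vα (comp S))) (allVec m)

-- Stable principal specialization of monomial quasi-symmetric functions.
-- psCount α lo N = #{ lo ≤ e_1 < … < e_k : Σ_j α_j e_j = N } for α
-- with positive parts; with lo = 0 this is the coefficient of q^N in
-- M_α(1,q,q²,…) (t_i = q^(i-1)).

psCount : List ℕ → ℕ → ℕ → ℕ
psCount [] lo N = if N ≡ᵇ 0 then 1 else 0
psCount (a ∷ α) lo N =
  sumℕ (map (λ i → if a * i ≤ᵇ N then psCount α (suc i) (N ∸ a * i) else 0)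
            (map (λ j → lo + j) (upTo (suc N ∸ lo))))

psM : List ℕ → Series
psM α N = + (psCount α 0 N)

-- γ(Σ_α c_α v_α) = Σ_α c_α M_α, so
-- ps*(γ(Σ_α c_α v_α)) = Σ_α c_α ps(M_{α*}).
psStarγ : (m : ℕ) → (Vec Bool m → ℤ) → Series
psStarγ m c N = sumℤ (map (λ S → c S *ℤ psM (reverse (comp S)) N) (allVec m))

record GradedPoset (n : ℕ) : Set₁ where
  field
    size      : ℕ
    _<P_      : Fin size → Fin size → Set
    <P-dec    : ∀ x y → Dec (x <P y)
    <P-irrefl : ∀ x → ¬ (x <P x)
    <P-trans  : ∀ {x y z} → x <P y → y <P z → x <P z
    bot top   : Fin size
    bot-min   : ∀ x → x ≢ bot → bot <P x
    top-max   : ∀ x → x ≢ top → x <P top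
    rank      : Fin size → ℕ
    rank-bot  : rank bot ≡ 0
    rank-top  : rank top ≡ n
    rank-cover : ∀ x y → x <P y → (∀ z → ¬ (x <P z × z <P y)) → rank y ≡ suc (rank x)

module _ {n : ℕ} (P : GradedPoset n) where
  open GradedPoset P

  ltB : Fin size → Fin size → Bool
  ltB x y with <P-dec x y
  ... | yes _ = true
  ... | no _ = false

  chainCount : Fin size → List ℕ → ℕ
  chainCount prev [] = if ltB prev top then 1 else 0
  chainCount prev (r ∷ rs) =
    sumℕ (map (λ x → if (rank x ≡ᵇ r) ∧ ltB prev x then chainCount x rs else 0)
              (allFin size))

elemsFrom : {m : ℕ} → ℕ → Vec Bool m → List ℕ
elemsFrom i [] = []
elemsFrom i (true ∷ s) = i ∷ elemsFrom (suc i) s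
elemsFrom i (false ∷ s) = elemsFrom (suc i) s

flagF : {m : ℕ} → GradedPoset (suc m) → Vec Bool m → ℕ
flagF P S = chainCount P (GradedPoset.bot P) (elemsFrom 1 S)

vS : {m : ℕ} → Vec Bool m → NCPoly
vS [] = oneP
vS (true ∷ s) = 𝐛 ⊗ vS s
vS (false ∷ s) = 𝐜 ⊗ vS s

Ψ : {m : ℕ} → GradedPoset (suc m) → NCPoly
Ψ {m} P = concatMap (λ S → scale (+ flagF P S) (vS S)) (allVec m)

-- Counting positions from i instead of 1 turns Θ into a multiplicative map: if every word of p
-- has length d then Θᵢ(p r) = Θᵢ(p) Θᵢ₊d(r), while Θᵢ(a - b) = 1 - q^i and Θᵢ(b) = q^i.  So for a
-- composition (α, b) of n, Θ(v_(α,b)) = Θ(v_α) q^|α| (1 - q^(|α|+1)) ⋯ (1 - q^(n-1)).  On the other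
-- side, splitting the sum defining ps(M_β) according to whether its smallest exponent is 0 gives
-- (1 - q^|β|) ps(M_β) = q^|γ| ps(M_γ) for β = (b, γ).  Induction on the last part of α then yields
-- Θ(v_α) = (1 - q)(1 - q²) ⋯ (1 - q^n) ps(M_α*), and this product is (1 - q)^n [n]!.  Both sides of
-- the theorem are linear in the coefficients c_α, and Θ(w) only depends on the coefficients of w.

module Submission where

open import Defs
open import Algebra.Bundles using (CommutativeRing)
import Algebra.Construct.Pointwise as Pointwise
import Algebra.Properties.CommutativeSemigroup as CommutativeSemigroupProperties
import Algebra.Properties.Ring as RingProperties
open import Data.Nat as ℕ using (ℕ; zero; suc; _+_; _*_; _∸_; _⊔_; _≤_; _<_; z<s; _≡ᵇ_; _<ᵇ_; _≤ᵇ_)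
open import Data.Nat.ListAction using (sum)
open import Data.Nat.Tactic.RingSolver using () renaming (solve-∀ to solve-∀ℕ)
import Data.Nat.Properties as ℕ
open import Data.Integer as ℤ using (ℤ; +_; -_)
  renaming (_+_ to _+ℤ_; _*_ to _*ℤ_)
import Data.Integer.Properties as ℤ
open import Data.Integer.Tactic.RingSolver using (solve-∀)
open import Data.Empty using (⊥-elim)
open import Data.Bool using (Bool; true; false; if_then_else_)
import Data.Bool.Properties as Bool
open import Function.Bundles using (Equivalence)
open import Data.List using (List; []; _∷_; _++_; _∷ʳ_; map; concatMap; upTo; applyUpTo; length; reverse)
open import Data.Vec using (Vec; []; _∷_)
open import Data.List.Reverse using (Reverse; []; _∶_∶ʳ_; reverseView)
open import Data.List.Relation.Binary.Permutation.Propositional using (↭-sym)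
open import Data.List.Relation.Binary.Permutation.Propositional.Properties using (↭-reverse; All-resp-↭)
import Data.Nat.ListAction.Properties as Sum
import Data.List.Properties as List
open import Data.Product using (_×_; _,_)
open import Data.List.Relation.Unary.All using (All; []; _∷_)
import Data.List.Relation.Unary.All as All
import Data.List.Relation.Unary.All.Properties as All
open import Function using (_∘_)
open import Level using (0ℓ)
open import Relation.Binary.Bundles using (Setoid)
import Relation.Binary.Reasoning.Setoid as SetoidReasoning
open import Relation.Binary.Core using (Rel)
open import Relation.Binary.PropositionalEquality

sumℤ-++ : ∀ xs ys → sumℤ (xs ++ ys) ≡ sumℤ xs +ℤ sumℤ ys
sumℤ-++ []       ys = sym (ℤ.+-identityˡ (sumℤ ys))
sumℤ-++ (x ∷ xs) ys = trans (cong (x +ℤ_) (sumℤ-++ xs ys)) (sym (ℤ.+-assoc x (sumℤ xs) (sumℤ ys)))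

sumℤ-map-++ : ∀ {A : Set} (f : A → ℤ) xs ys → sumℤ (map f (xs ++ ys)) ≡ sumℤ (map f xs) +ℤ sumℤ (map f ys)
sumℤ-map-++ f xs ys = trans (cong sumℤ (List.map-++ f xs ys)) (sumℤ-++ (map f xs) (map f ys))

sumℤ-map-cong : ∀ {A : Set} {f g : A → ℤ} xs → (∀ x → f x ≡ g x) → sumℤ (map f xs) ≡ sumℤ (map g xs)
sumℤ-map-cong []       f≡g = refl
sumℤ-map-cong (x ∷ xs) f≡g = cong₂ _+ℤ_ (f≡g x) (sumℤ-map-cong xs f≡g)

sumℤ-map-+ : ∀ {A : Set} (f g : A → ℤ) xs →
  sumℤ (map (λ x → f x +ℤ g x) xs) ≡ sumℤ (map f xs) +ℤ sumℤ (map g xs)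
sumℤ-map-+ f g []       = refl
sumℤ-map-+ f g (x ∷ xs) = trans (cong (f x +ℤ g x +ℤ_) (sumℤ-map-+ f g xs)) (swap (f x) (g x) _ _)
  where
  swap : ∀ a b c d → a +ℤ b +ℤ (c +ℤ d) ≡ a +ℤ c +ℤ (b +ℤ d)
  swap = solve-∀

sumℤ-map-0 : ∀ {A : Set} (xs : List A) → sumℤ (map (λ _ → + 0) xs) ≡ + 0
sumℤ-map-0 []       = refl
sumℤ-map-0 (x ∷ xs) = cong (+ 0 +ℤ_) (sumℤ-map-0 xs)

infix  4 _≐_
infixl 6 _+ˢ_
infixl 7 _·ˢ_

_≐_ : Rel Series 0ℓ
f ≐ g = ∀ N → f N ≡ g N

0ˢ : Series
0ˢ _ = + 0

_+ˢ_ : Series → Series → Series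
(f +ˢ g) N = f N +ℤ g N

-ˢ_ : Series → Series
(-ˢ f) N = - f N

_·ˢ_ : ℤ → Series → Series
(c ·ˢ f) N = c *ℤ f N

≐-setoid : Setoid 0ℓ 0ℓ
≐-setoid = record { isEquivalence = Pointwise.isEquivalence ℕ (isEquivalence {A = ℤ}) }

open Setoid ≐-setoid using () renaming (refl to ≐-refl; reflexive to ≐-reflexive; sym to ≐-sym; trans to ≐-trans)
module ≐-Reasoning = SetoidReasoning ≐-setoid

shift : ℕ → Series → Series
shift zero    f N       = f N
shift (suc k) f zero    = + 0
shift (suc k) f (suc N) = shift k f N

shift-cong : ∀ k {f g} → f ≐ g → shift k f ≐ shift k g
shift-cong zero    f≐g N       = f≐g N
shift-cong (suc k) f≐g zero    = refl
shift-cong (suc k) f≐g (suc N) = shift-cong k f≐g N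

shift-+ˢ : ∀ k f g → shift k (f +ˢ g) ≐ shift k f +ˢ shift k g
shift-+ˢ zero    f g N       = refl
shift-+ˢ (suc k) f g zero    = refl
shift-+ˢ (suc k) f g (suc N) = shift-+ˢ k f g N

shift-0ˢ : ∀ k → shift k 0ˢ ≐ 0ˢ
shift-0ˢ zero    N       = refl
shift-0ˢ (suc k) zero    = refl
shift-0ˢ (suc k) (suc N) = shift-0ˢ k N

qPow : ℕ → Series
qPow k = shift k oneS

oneMinusQPow : ℕ → Series
oneMinusQPow k = oneS +ˢ -ˢ qPow k

-- A recursive form of the Cauchy product ⊛, used to prove its ring laws.
private
  tail : Series → Series
  tail f N = f (suc N)

  conv : Series → Series → Series
  conv f g zero    = f 0 *ℤ g 0
  conv f g (suc N) = f 0 *ℤ g (suc N) +ℤ conv (tail f) g N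

  ⊛≐conv : ∀ f g → f ⊛ g ≐ conv f g
  ⊛≐conv f g N = trans (cong (sumℤ) (List.map-upTo (λ i → f i *ℤ g (N ∸ i)) (suc N))) (go f N)
    where
    go : ∀ f N → sumℤ (applyUpTo (λ i → f i *ℤ g (N ∸ i)) (suc N)) ≡ conv f g N
    go f zero    = ℤ.+-identityʳ _
    go f (suc N) = cong (f 0 *ℤ g (suc N) +ℤ_) (go (tail f) N)

  conv-cong : ∀ {f f′ g g′} → f ≐ f′ → g ≐ g′ → conv f g ≐ conv f′ g′
  conv-cong f≐f′ g≐g′ zero    = cong₂ _*ℤ_ (f≐f′ 0) (g≐g′ 0)
  conv-cong f≐f′ g≐g′ (suc N) =
    cong₂ _+ℤ_ (cong₂ _*ℤ_ (f≐f′ 0) (g≐g′ (suc N))) (conv-cong (f≐f′ ∘ suc) g≐g′ N)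

  conv-zeroˡ : ∀ g → conv 0ˢ g ≐ 0ˢ
  conv-zeroˡ g zero    = refl
  conv-zeroˡ g (suc N) = cong (+ 0 +ℤ_) (conv-zeroˡ g N)

  conv-identityˡ : ∀ g → conv oneS g ≐ g
  conv-identityˡ g zero    = ℤ.*-identityˡ (g 0)
  conv-identityˡ g (suc N) =
    trans (cong₂ _+ℤ_ (ℤ.*-identityˡ (g (suc N))) (conv-zeroˡ g N)) (ℤ.+-identityʳ _)

  conv-distribʳ : ∀ f f′ g → conv (f +ˢ f′) g ≐ conv f g +ˢ conv f′ g
  conv-distribʳ f f′ g zero    = ℤ.*-distribʳ-+ (g 0) (f 0) (f′ 0)
  conv-distribʳ f f′ g (suc N) =
    trans (cong ((f 0 +ℤ f′ 0) *ℤ g (suc N) +ℤ_) (conv-distribʳ (tail f) (tail f′) g N))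
          (lemma (f 0) (f′ 0) (g (suc N)) _ _)
    where
    lemma : ∀ a b c d e → (a +ℤ b) *ℤ c +ℤ (d +ℤ e) ≡ (a *ℤ c +ℤ d) +ℤ (b *ℤ c +ℤ e)
    lemma = solve-∀

  conv-scaleˡ : ∀ c f g → conv (c ·ˢ f) g ≐ c ·ˢ conv f g
  conv-scaleˡ c f g zero    = ℤ.*-assoc c (f 0) (g 0)
  conv-scaleˡ c f g (suc N) =
    trans (cong ((c *ℤ f 0) *ℤ g (suc N) +ℤ_) (conv-scaleˡ c (tail f) g N))
          (lemma c (f 0) (g (suc N)) _)
    where
    lemma : ∀ a b c d → a *ℤ b *ℤ c +ℤ a *ℤ d ≡ a *ℤ (b *ℤ c +ℤ d)
    lemma = solve-∀

  conv-shiftˡ : ∀ k f g → conv (shift k f) g ≐ shift k (conv f g)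
  conv-shiftˡ zero    f g N       = refl
  conv-shiftˡ (suc k) f g zero    = ℤ.*-zeroˡ (g 0)
  conv-shiftˡ (suc k) f g (suc N) =
    trans (cong₂ _+ℤ_ (ℤ.*-zeroˡ (g (suc N))) (conv-shiftˡ k f g N)) (ℤ.+-identityˡ _)

  conv-suc-right : ∀ f g N → conv f g (suc N) ≡ conv f (tail g) N +ℤ f (suc N) *ℤ g 0
  conv-suc-right f g zero    = refl
  conv-suc-right f g (suc N) =
    trans (cong (f 0 *ℤ g (suc (suc N)) +ℤ_) (conv-suc-right (tail f) g N))
          (sym (ℤ.+-assoc (f 0 *ℤ g (suc (suc N))) (conv (tail f) (tail g) N) (f (suc (suc N)) *ℤ g 0)))

  conv-comm : ∀ f g → conv f g ≐ conv g f
  conv-comm f g zero    = ℤ.*-comm (f 0) (g 0)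
  conv-comm f g (suc N) = begin
    f 0 *ℤ g (suc N) +ℤ conv (tail f) g N  ≡⟨ cong₂ _+ℤ_ (ℤ.*-comm (f 0) (g (suc N))) (conv-comm (tail f) g N) ⟩
    g (suc N) *ℤ f 0 +ℤ conv g (tail f) N  ≡⟨ ℤ.+-comm (g (suc N) *ℤ f 0) (conv g (tail f) N) ⟩
    conv g (tail f) N +ℤ g (suc N) *ℤ f 0  ≡⟨ sym (conv-suc-right g f N) ⟩
    conv g f (suc N)                        ∎
    where open ≡-Reasoning

  conv-assoc : ∀ f g h → conv (conv f g) h ≐ conv f (conv g h)
  conv-assoc f g h zero    = ℤ.*-assoc (f 0) (g 0) (h 0)
  conv-assoc f g h (suc N) = begin
    f 0 *ℤ g 0 *ℤ h (suc N) +ℤ conv (f 0 ·ˢ tail g +ˢ conv (tail f) g) h N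
      ≡⟨ cong (f 0 *ℤ g 0 *ℤ h (suc N) +ℤ_) (conv-distribʳ (f 0 ·ˢ tail g) (conv (tail f) g) h N) ⟩
    f 0 *ℤ g 0 *ℤ h (suc N) +ℤ (conv (f 0 ·ˢ tail g) h N +ℤ conv (conv (tail f) g) h N)
      ≡⟨ cong₂ (λ x y → f 0 *ℤ g 0 *ℤ h (suc N) +ℤ (x +ℤ y))
           (conv-scaleˡ (f 0) (tail g) h N) (conv-assoc (tail f) g h N) ⟩
    f 0 *ℤ g 0 *ℤ h (suc N) +ℤ (f 0 *ℤ conv (tail g) h N +ℤ conv (tail f) (conv g h) N)
      ≡⟨ lemma (f 0) (g 0) (h (suc N)) _ _ ⟩
    f 0 *ℤ (g 0 *ℤ h (suc N) +ℤ conv (tail g) h N) +ℤ conv (tail f) (conv g h) N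
      ∎
    where
    open ≡-Reasoning
    lemma : ∀ a b c x y → a *ℤ b *ℤ c +ℤ (a *ℤ x +ℤ y) ≡ a *ℤ (b *ℤ c +ℤ x) +ℤ y
    lemma = solve-∀

⊛-cong : ∀ {f f′ g g′} → f ≐ f′ → g ≐ g′ → f ⊛ g ≐ f′ ⊛ g′
⊛-cong {f} {f′} {g} {g′} f≐f′ g≐g′ N =
  trans (⊛≐conv f g N) (trans (conv-cong f≐f′ g≐g′ N) (sym (⊛≐conv f′ g′ N)))

⊛-congˡ : ∀ f {g g′} → g ≐ g′ → f ⊛ g ≐ f ⊛ g′
⊛-congˡ f = ⊛-cong {f} {f} ≐-refl

⊛-congʳ : ∀ h {f f′} → f ≐ f′ → f ⊛ h ≐ f′ ⊛ h
⊛-congʳ h f≐f′ = ⊛-cong {g = h} {h} f≐f′ ≐-refl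

private
  ⊛≐conv² : ∀ f g h → (f ⊛ g) ⊛ h ≐ conv (conv f g) h
  ⊛≐conv² f g h N = trans (⊛≐conv (f ⊛ g) h N) (conv-cong (⊛≐conv f g) ≐-refl N)

  ⊛≐conv²′ : ∀ f g h → f ⊛ (g ⊛ h) ≐ conv f (conv g h)
  ⊛≐conv²′ f g h N = trans (⊛≐conv f (g ⊛ h) N) (conv-cong ≐-refl (⊛≐conv g h) N)

⊛-comm : ∀ f g → f ⊛ g ≐ g ⊛ f
⊛-comm f g N = trans (⊛≐conv f g N) (trans (conv-comm f g N) (sym (⊛≐conv g f N)))

⊛-assoc : ∀ f g h → (f ⊛ g) ⊛ h ≐ f ⊛ (g ⊛ h)
⊛-assoc f g h N = trans (⊛≐conv² f g h N) (trans (conv-assoc f g h N) (sym (⊛≐conv²′ f g h N)))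

⊛-identityˡ : ∀ f → oneS ⊛ f ≐ f
⊛-identityˡ f N = trans (⊛≐conv oneS f N) (conv-identityˡ f N)

⊛-distribʳ : ∀ h f g → (f +ˢ g) ⊛ h ≐ f ⊛ h +ˢ g ⊛ h
⊛-distribʳ h f g N =
  trans (⊛≐conv (f +ˢ g) h N)
    (trans (conv-distribʳ f g h N) (sym (cong₂ _+ℤ_ (⊛≐conv f h N) (⊛≐conv g h N))))

⊛-scaleˡ : ∀ c f g → (c ·ˢ f) ⊛ g ≐ c ·ˢ (f ⊛ g)
⊛-scaleˡ c f g N =
  trans (⊛≐conv (c ·ˢ f) g N) (trans (conv-scaleˡ c f g N) (cong (c *ℤ_) (sym (⊛≐conv f g N))))

⊛-scaleʳ : ∀ c f g → f ⊛ (c ·ˢ g) ≐ c ·ˢ (f ⊛ g)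
⊛-scaleʳ c f g N = trans (⊛-comm f (c ·ˢ g) N) (trans (⊛-scaleˡ c g f N) (cong (c *ℤ_) (⊛-comm g f N)))

⊛-shiftˡ : ∀ k f g → shift k f ⊛ g ≐ shift k (f ⊛ g)
⊛-shiftˡ k f g N =
  trans (⊛≐conv (shift k f) g N) (trans (conv-shiftˡ k f g N) (shift-cong k (≐-sym (⊛≐conv f g)) N))

seriesRing : CommutativeRing 0ℓ 0ℓ
seriesRing = record
  { Carrier = Series
  ; _≈_ = _≐_
  ; _+_ = _+ˢ_
  ; _*_ = _⊛_
  ; -_ = -ˢ_
  ; 0# = 0ˢ
  ; 1# = oneS
  ; isCommutativeRing = record
    { isRing = record
      { +-isAbelianGroup = Pointwise.isAbelianGroup ℕ ℤ.+-0-isAbelianGroup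
      ; *-cong = ⊛-cong
      ; *-assoc = ⊛-assoc
      ; *-identity = ⊛-identityˡ , λ f → ≐-trans (⊛-comm f oneS) (⊛-identityˡ f)
      ; distrib = (λ h f g → ≐-trans (⊛-comm h (f +ˢ g)) (≐-trans (⊛-distribʳ h f g)
                     (λ N → cong₂ _+ℤ_ (⊛-comm f h N) (⊛-comm g h N))))
                , ⊛-distribʳ
      }
    ; *-comm = ⊛-comm
    }
  }

module SeriesRing = CommutativeRing seriesRing
open CommutativeSemigroupProperties SeriesRing.*-commutativeSemigroup using (interchange; xy∙z≈z∙yx)
open RingProperties SeriesRing.ring using (-‿distribˡ-*)

qPow-⊛ : ∀ k f → qPow k ⊛ f ≐ shift k f
qPow-⊛ k f = ≐-trans (⊛-shiftˡ k oneS f) (shift-cong k (⊛-identityˡ f))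

oneMinusQPow-⊛ : ∀ k f → oneMinusQPow k ⊛ f ≐ f +ˢ -ˢ shift k f
oneMinusQPow-⊛ k f = begin
  (oneS +ˢ -ˢ qPow k) ⊛ f
    ≈⟨ ⊛-distribʳ f oneS (-ˢ qPow k) ⟩
  oneS ⊛ f +ˢ (-ˢ qPow k) ⊛ f
    ≈⟨ SeriesRing.+-cong (⊛-identityˡ f) (≐-trans (≐-sym (-‿distribˡ-* (qPow k) f)) (SeriesRing.-‿cong (qPow-⊛ k f))) ⟩
  f +ˢ -ˢ shift k f
    ∎
  where open ≐-Reasoning

pochhammer : ℕ → ℕ → Series
pochhammer i zero    = oneS
pochhammer i (suc k) = oneMinusQPow i ⊛ pochhammer (suc i) k

pochhammer-+ : ∀ i k j → pochhammer i (k + j) ≐ pochhammer i k ⊛ pochhammer (i + k) j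
pochhammer-+ i zero    j =
  ≐-trans (≐-reflexive (cong (λ i → pochhammer i j) (sym (ℕ.+-identityʳ i)))) (≐-sym (⊛-identityˡ (pochhammer (i + 0) j)))
pochhammer-+ i (suc k) j = begin
  oneMinusQPow i ⊛ pochhammer (suc i) (k + j)
    ≈⟨ ⊛-congˡ (oneMinusQPow i) (pochhammer-+ (suc i) k j) ⟩
  oneMinusQPow i ⊛ (pochhammer (suc i) k ⊛ pochhammer (suc i + k) j)
    ≈⟨ ⊛-assoc (oneMinusQPow i) (pochhammer (suc i) k) (pochhammer (suc i + k) j) ⟨
  pochhammer i (suc k) ⊛ pochhammer (suc i + k) j
    ≡⟨ cong (λ n → pochhammer i (suc k) ⊛ pochhammer n j) (sym (ℕ.+-suc i k)) ⟩
  pochhammer i (suc k) ⊛ pochhammer (i + suc k) j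
    ∎
  where open ≐-Reasoning

pochhammer-suc : ∀ i k → pochhammer i (suc k) ≐ pochhammer i k ⊛ oneMinusQPow (i + k)
pochhammer-suc i k = begin
  pochhammer i (suc k)
    ≡⟨ cong (pochhammer i) (ℕ.+-comm 1 k) ⟩
  pochhammer i (k + 1)
    ≈⟨ pochhammer-+ i k 1 ⟩
  pochhammer i k ⊛ (oneMinusQPow (i + k) ⊛ oneS)
    ≈⟨ ⊛-congˡ (pochhammer i k) (SeriesRing.*-identityʳ (oneMinusQPow (i + k))) ⟩
  pochhammer i k ⊛ oneMinusQPow (i + k)
    ∎
  where open ≐-Reasoning

oneMinusQ≐oneMinusQPow1 : oneMinusQ ≐ oneMinusQPow 1
oneMinusQ≐oneMinusQPow1 zero          = refl
oneMinusQ≐oneMinusQPow1 (suc zero)    = refl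
oneMinusQ≐oneMinusQPow1 (suc (suc N)) = refl

oneMinusQ-⊛-qint : ∀ k → oneMinusQ ⊛ qint k ≐ oneMinusQPow k
oneMinusQ-⊛-qint k = begin
  oneMinusQ ⊛ qint k                  ≈⟨ ⊛-congʳ (qint k) oneMinusQ≐oneMinusQPow1 ⟩
  oneMinusQPow 1 ⊛ qint k             ≈⟨ oneMinusQPow-⊛ 1 (qint k) ⟩
  qint k +ˢ -ˢ shift 1 (qint k)       ≈⟨ telescope k ⟩
  oneMinusQPow k                      ∎
  where
  open ≐-Reasoning
  -- the coefficient of q^(M+1), with [k + 1] unfolded
  telescope-suc : ∀ k M → (if M <ᵇ k then + 1 else + 0) +ℤ - (if M <ᵇ suc k then + 1 else + 0) ≡ + 0 +ℤ - qPow k M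
  telescope-suc zero    zero    = refl
  telescope-suc (suc k) zero    = refl
  telescope-suc zero    (suc M) = refl
  telescope-suc (suc k) (suc M) = telescope-suc k M
  telescope : ∀ k → qint k +ˢ -ˢ shift 1 (qint k) ≐ oneMinusQPow k
  telescope zero    zero    = refl
  telescope (suc k) zero    = refl
  telescope zero    (suc M) = refl
  telescope (suc k) (suc M) = telescope-suc k M

qfact-pochhammer : ∀ n → powS oneMinusQ n ⊛ qfact n ≐ pochhammer 1 n
qfact-pochhammer zero    = ⊛-identityˡ oneS
qfact-pochhammer (suc n) = begin
  (oneMinusQ ⊛ powS oneMinusQ n) ⊛ (qint (suc n) ⊛ qfact n)
    ≈⟨ interchange oneMinusQ (powS oneMinusQ n) (qint (suc n)) (qfact n) ⟩
  (oneMinusQ ⊛ qint (suc n)) ⊛ (powS oneMinusQ n ⊛ qfact n)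
    ≈⟨ ⊛-cong (oneMinusQ-⊛-qint (suc n)) (qfact-pochhammer n) ⟩
  oneMinusQPow (suc n) ⊛ pochhammer 1 n
    ≈⟨ ⊛-comm (oneMinusQPow (suc n)) (pochhammer 1 n) ⟩
  pochhammer 1 n ⊛ oneMinusQPow (suc n)
    ≈⟨ pochhammer-suc 1 n ⟨
  pochhammer 1 (suc n)
    ∎
  where open ≐-Reasoning

monomial : ℤ → ℕ → Series
monomial c k N = if k ≡ᵇ N then c else + 0

-- Θ with the letters of a word placed at positions i, i + 1, …; Θ is ΘFrom 1.
ΘTerm : ℕ → ℕ → ℤ × Word → ℤ
ΘTerm i N (c , u) = monomial c (weightFrom i u) N

ΘFrom : ℕ → NCPoly → Series
ΘFrom i p N = sumℤ (map (ΘTerm i N) p)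

monomial≐ : ∀ c k → monomial c k ≐ c ·ˢ qPow k
monomial≐ c zero    zero    = sym (ℤ.*-identityʳ c)
monomial≐ c zero    (suc N) = sym (ℤ.*-zeroʳ c)
monomial≐ c (suc k) zero    = sym (ℤ.*-zeroʳ c)
monomial≐ c (suc k) (suc N) = monomial≐ c k N

monomial-⊛ : ∀ c k f → monomial c k ⊛ f ≐ c ·ˢ shift k f
monomial-⊛ c k f = begin
  monomial c k ⊛ f      ≈⟨ ⊛-congʳ f (monomial≐ c k) ⟩
  (c ·ˢ qPow k) ⊛ f     ≈⟨ ⊛-scaleˡ c (qPow k) f ⟩
  c ·ˢ (qPow k ⊛ f)     ≈⟨ (λ N → cong (c *ℤ_) (qPow-⊛ k f N)) ⟩
  c ·ˢ shift k f        ∎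
  where open ≐-Reasoning

monomial-* : ∀ c d k → monomial (c *ℤ d) k ≐ c ·ˢ monomial d k
monomial-* c d k N with k ≡ᵇ N
... | true  = refl
... | false = sym (ℤ.*-zeroʳ c)

monomial-shift : ∀ c d k l → monomial (c *ℤ d) (k + l) ≐ c ·ˢ shift k (monomial d l)
monomial-shift c d zero    l N       = monomial-* c d l N
monomial-shift c d (suc k) l zero    = sym (ℤ.*-zeroʳ c)
monomial-shift c d (suc k) l (suc N) = monomial-shift c d k l N

ΘFrom-++ : ∀ i p r → ΘFrom i (p ++ r) ≐ ΘFrom i p +ˢ ΘFrom i r
ΘFrom-++ i p r N = sumℤ-map-++ (ΘTerm i N) p r

weightFrom-++ : ∀ i u v → weightFrom i (u ++ v) ≡ weightFrom i u + weightFrom (i + length u) v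
weightFrom-++ i []         v = cong (λ j → weightFrom j v) (sym (ℕ.+-identityʳ i))
weightFrom-++ i (true ∷ u) v = begin
  i + weightFrom (suc i) (u ++ v)
    ≡⟨ cong (λ n → i + n) (weightFrom-++ (suc i) u v) ⟩
  i + (weightFrom (suc i) u + weightFrom (suc i + length u) v)
    ≡⟨ ℕ.+-assoc i _ _ ⟨
  i + weightFrom (suc i) u + weightFrom (suc i + length u) v
    ≡⟨ cong (λ j → i + weightFrom (suc i) u + weightFrom j v) (ℕ.+-suc i (length u)) ⟨
  i + weightFrom (suc i) u + weightFrom (i + suc (length u)) v
    ∎
  where open ≡-Reasoning
weightFrom-++ i (false ∷ u) v =
  trans (weightFrom-++ (suc i) u v)
        (cong (λ j → weightFrom (suc i) u + weightFrom j v) (sym (ℕ.+-suc i (length u))))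

ΘFrom-monomial-⊗ : ∀ i c u r →
  ΘFrom i (((c , u) ∷ []) ⊗ r) ≐ c ·ˢ shift (weightFrom i u) (ΘFrom (i + length u) r)
ΘFrom-monomial-⊗ i c u []            N = sym (trans (cong (c *ℤ_) (shift-0ˢ (weightFrom i u) N)) (ℤ.*-zeroʳ c))
ΘFrom-monomial-⊗ i c u ((d , v) ∷ r) N = begin
  monomial (c *ℤ d) (weightFrom i (u ++ v)) N +ℤ ΘFrom i (((c , u) ∷ []) ⊗ r) N
    ≡⟨ cong₂ _+ℤ_ (trans (cong (λ k → monomial (c *ℤ d) k N) (weightFrom-++ i u v))
                         (monomial-shift c d w (weightFrom j v) N))
                  (ΘFrom-monomial-⊗ i c u r N) ⟩
  c *ℤ shift w (monomial d (weightFrom j v)) N +ℤ c *ℤ shift w (ΘFrom j r) N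
    ≡⟨ ℤ.*-distribˡ-+ c _ _ ⟨
  c *ℤ (shift w (monomial d (weightFrom j v)) N +ℤ shift w (ΘFrom j r) N)
    ≡⟨ cong (c *ℤ_) (shift-+ˢ w (monomial d (weightFrom j v)) (ΘFrom j r) N) ⟨
  c *ℤ shift w (ΘFrom j ((d , v) ∷ r)) N
    ∎
  where
  open ≡-Reasoning
  w = weightFrom i u
  j = i + length u

ΘFrom-scale : ∀ i c p → ΘFrom i (scale c p) ≐ c ·ˢ ΘFrom i p
ΘFrom-scale i c []            N = sym (ℤ.*-zeroʳ c)
ΘFrom-scale i c ((d , u) ∷ p) N =
  trans (cong₂ _+ℤ_ (monomial-* c d (weightFrom i u) N) (ΘFrom-scale i c p N))
        (sym (ℤ.*-distribˡ-+ c (monomial d (weightFrom i u) N) (ΘFrom i p N)))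

⊗-∷ˡ : ∀ t p r → (t ∷ p) ⊗ r ≡ ((t ∷ []) ⊗ r) ++ (p ⊗ r)
⊗-∷ˡ (c , u) p r = cong (_++ p ⊗ r) (sym (List.++-identityʳ _))

OfDegree : ℕ → NCPoly → Set
OfDegree d = All (λ (_ , u) → length u ≡ d)

ΘFrom-⊗ : ∀ {d} i p r → OfDegree d p → ΘFrom i (p ⊗ r) ≐ ΘFrom i p ⊛ ΘFrom (i + d) r
ΘFrom-⊗ {d} i []            r []           = ≐-sym (SeriesRing.zeroˡ (ΘFrom (i + d) r))
ΘFrom-⊗ {d} i ((c , u) ∷ p) r (refl ∷ p-d) = begin
  ΘFrom i (((c , u) ∷ p) ⊗ r)
    ≡⟨ cong (ΘFrom i) (⊗-∷ˡ (c , u) p r) ⟩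
  ΘFrom i (((c , u) ∷ []) ⊗ r ++ p ⊗ r)
    ≈⟨ ΘFrom-++ i (((c , u) ∷ []) ⊗ r) (p ⊗ r) ⟩
  ΘFrom i (((c , u) ∷ []) ⊗ r) +ˢ ΘFrom i (p ⊗ r)
    ≈⟨ SeriesRing.+-cong (ΘFrom-monomial-⊗ i c u r) (ΘFrom-⊗ i p r p-d) ⟩
  c ·ˢ shift (weightFrom i u) R +ˢ ΘFrom i p ⊛ R
    ≈⟨ SeriesRing.+-congʳ (monomial-⊛ c (weightFrom i u) R) ⟨
  monomial c (weightFrom i u) ⊛ R +ˢ ΘFrom i p ⊛ R
    ≈⟨ ⊛-distribʳ R (monomial c (weightFrom i u)) (ΘFrom i p) ⟨
  ΘFrom i ((c , u) ∷ p) ⊛ R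
    ∎
  where
  open ≐-Reasoning
  R = ΘFrom (i + length u) r

OfDegree-⊗ : ∀ {d e} p r → OfDegree d p → OfDegree e r → OfDegree (d + e) (p ⊗ r)
OfDegree-⊗ []            r []           r-e = []
OfDegree-⊗ ((c , u) ∷ p) r (u-d ∷ p-d) r-e =
  subst (OfDegree _) (sym (⊗-∷ˡ (c , u) p r)) (All.++⁺ (row r r-e) (OfDegree-⊗ p r p-d r-e))
  where
  row : ∀ r → OfDegree _ r → OfDegree _ (((c , u) ∷ []) ⊗ r)
  row []            []          = []
  row ((x , v) ∷ r) (v-e ∷ r-e) = trans (List.length-++ u) (cong₂ _+_ u-d v-e) ∷ row r r-e

ΘFrom-oneP : ∀ i → ΘFrom i oneP ≐ oneS
ΘFrom-oneP i zero    = refl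
ΘFrom-oneP i (suc N) = refl

ΘFrom-𝐚 : ∀ i → ΘFrom i 𝐚 ≐ oneS
ΘFrom-𝐚 i zero    = refl
ΘFrom-𝐚 i (suc N) = refl

ΘFrom-𝐛 : ∀ i → ΘFrom i 𝐛 ≐ qPow i
ΘFrom-𝐛 i N = begin
  monomial (+ 1) (i + 0) N +ℤ + 0  ≡⟨ ℤ.+-identityʳ _ ⟩
  monomial (+ 1) (i + 0) N         ≡⟨ cong (λ k → monomial (+ 1) k N) (ℕ.+-identityʳ i) ⟩
  monomial (+ 1) i N               ≡⟨ monomial≐ (+ 1) i N ⟩
  + 1 *ℤ qPow i N                  ≡⟨ ℤ.*-identityˡ _ ⟩
  qPow i N                         ∎
  where open ≡-Reasoning

ΘFrom-𝐜 : ∀ i → ΘFrom i 𝐜 ≐ oneMinusQPow i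
ΘFrom-𝐜 i N = begin
  ΘFrom i (𝐚 ++ scale (- + 1) 𝐛) N               ≡⟨ ΘFrom-++ i 𝐚 (scale (- + 1) 𝐛) N ⟩
  ΘFrom i 𝐚 N +ℤ ΘFrom i (scale (- + 1) 𝐛) N     ≡⟨ cong (ΘFrom i 𝐚 N +ℤ_) (ΘFrom-scale i (- + 1) 𝐛 N) ⟩
  ΘFrom i 𝐚 N +ℤ - + 1 *ℤ ΘFrom i 𝐛 N            ≡⟨ cong₂ (λ x y → x +ℤ - + 1 *ℤ y) (ΘFrom-𝐚 i N) (ΘFrom-𝐛 i N) ⟩
  oneS N +ℤ - + 1 *ℤ qPow i N                     ≡⟨ cong (oneS N +ℤ_) (ℤ.-1*i≡-i (qPow i N)) ⟩
  oneS N +ℤ - qPow i N                            ∎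
  where open ≡-Reasoning

OfDegree-powP𝐜 : ∀ k → OfDegree k (powP 𝐜 k)
OfDegree-powP𝐜 zero    = refl ∷ []
OfDegree-powP𝐜 (suc k) = OfDegree-⊗ 𝐜 (powP 𝐜 k) (refl ∷ refl ∷ []) (OfDegree-powP𝐜 k)

ΘFrom-powP𝐜 : ∀ i k → ΘFrom i (powP 𝐜 k) ≐ pochhammer i k
ΘFrom-powP𝐜 i zero    = ΘFrom-oneP i
ΘFrom-powP𝐜 i (suc k) = begin
  ΘFrom i (𝐜 ⊗ powP 𝐜 k)                      ≈⟨ ΘFrom-⊗ i 𝐜 (powP 𝐜 k) (refl ∷ refl ∷ []) ⟩
  ΘFrom i 𝐜 ⊛ ΘFrom (i + 1) (powP 𝐜 k)        ≡⟨ cong (λ j → ΘFrom i 𝐜 ⊛ ΘFrom j (powP 𝐜 k)) (ℕ.+-comm i 1) ⟩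
  ΘFrom i 𝐜 ⊛ ΘFrom (suc i) (powP 𝐜 k)        ≈⟨ ⊛-cong (ΘFrom-𝐜 i) (ΘFrom-powP𝐜 (suc i) k) ⟩
  oneMinusQPow i ⊛ pochhammer (suc i) k        ∎
  where open ≐-Reasoning

wordsUpTo : ℕ → List Word
wordsUpTo zero    = [] ∷ []
wordsUpTo (suc L) = [] ∷ map (false ∷_) (wordsUpTo L) ++ map (true ∷_) (wordsUpTo L)

sum-wordsUpTo-select : ∀ L v (h : Word → ℤ) →
  sumℤ (map (λ u → if eqWord v u then h u else + 0) (wordsUpTo L)) ≡ (if length v ≤ᵇ L then h v else + 0)
sum-wordsUpTo-select zero    []      h = ℤ.+-identityʳ (h [])
sum-wordsUpTo-select zero    (_ ∷ _) h = refl
sum-wordsUpTo-select (suc L) v       h = begin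
  sel v [] +ℤ sumℤ (map (sel v) (map (false ∷_) W ++ map (true ∷_) W))
    ≡⟨ cong (sel v [] +ℤ_) (sumℤ-map-++ (sel v) (map (false ∷_) W) (map (true ∷_) W)) ⟩
  sel v [] +ℤ (sumℤ (map (sel v) (map (false ∷_) W)) +ℤ sumℤ (map (sel v) (map (true ∷_) W)))
    ≡⟨ cong₂ (λ x y → sel v [] +ℤ (x +ℤ y)) (cong sumℤ (List.map-∘ W)) (cong sumℤ (List.map-∘ W)) ⟨
  sel v [] +ℤ (sumℤ (map (sel v ∘ (false ∷_)) W) +ℤ sumℤ (map (sel v ∘ (true ∷_)) W))
    ≡⟨ by-first-letter v ⟩
  (if length v ≤ᵇ suc L then h v else + 0)
    ∎
  where
  open ≡-Reasoning
  W = wordsUpTo L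
  sel : Word → Word → ℤ
  sel v u = if eqWord v u then h u else + 0
  select-suc : ∀ k (x : ℤ) → (if k ≤ᵇ L then x else + 0) ≡ (if suc k ≤ᵇ suc L then x else + 0)
  select-suc zero    x = refl
  select-suc (suc k) x = refl
  by-first-letter : ∀ v → sel v [] +ℤ (sumℤ (map (sel v ∘ (false ∷_)) W) +ℤ sumℤ (map (sel v ∘ (true ∷_)) W))
                          ≡ (if length v ≤ᵇ suc L then h v else + 0)
  by-first-letter []          =
    trans (cong (λ x → h [] +ℤ (x +ℤ x)) (sumℤ-map-0 W)) (ℤ.+-identityʳ (h []))
  by-first-letter (false ∷ v) =
    trans (cong₂ (λ x y → + 0 +ℤ (x +ℤ y)) (sum-wordsUpTo-select L v (h ∘ (false ∷_))) (sumℤ-map-0 W))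
          (trans (ℤ.+-identityˡ _) (trans (ℤ.+-identityʳ _) (select-suc (length v) (h (false ∷ v)))))
  by-first-letter (true ∷ v)  =
    trans (cong₂ (λ x y → + 0 +ℤ (x +ℤ y)) (sumℤ-map-0 W) (sum-wordsUpTo-select L v (h ∘ (true ∷_))))
          (trans (ℤ.+-identityˡ _) (trans (ℤ.+-identityˡ _) (select-suc (length v) (h (true ∷ v)))))

monomial-+ : ∀ a b k N → monomial (a +ℤ b) k N ≡ monomial a k N +ℤ monomial b k N
monomial-+ a b k N with k ≡ᵇ N
... | true  = refl
... | false = refl

monomial-0 : ∀ k N → monomial (+ 0) k N ≡ + 0
monomial-0 k N = Bool.if-eta (k ≡ᵇ N)

maxLength : NCPoly → ℕ
maxLength []            = 0
maxLength ((_ , u) ∷ p) = length u ⊔ maxLength p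

LengthsAtMost : ℕ → NCPoly → Set
LengthsAtMost L = All (λ (_ , u) → length u ≤ L)

LengthsAtMost-mono : ∀ {L L′} p → L ≤ L′ → LengthsAtMost L p → LengthsAtMost L′ p
LengthsAtMost-mono p L≤L′ = All.map (λ ≤L → ℕ.≤-trans ≤L L≤L′)

LengthsAtMost-maxLength : ∀ p → LengthsAtMost (maxLength p) p
LengthsAtMost-maxLength []            = []
LengthsAtMost-maxLength ((_ , u) ∷ p) =
  ℕ.m≤m⊔n (length u) (maxLength p) ∷
  LengthsAtMost-mono p (ℕ.m≤n⊔m (length u) (maxLength p)) (LengthsAtMost-maxLength p)

Θ-coeff : ∀ L p → LengthsAtMost L p → ∀ N →
  Θ p N ≡ sumℤ (map (λ u → monomial (coeff p u) (majWeight u) N) (wordsUpTo L))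
Θ-coeff L []            []            N =
  sym (trans (sumℤ-map-cong (wordsUpTo L) (λ u → monomial-0 (majWeight u) N)) (sumℤ-map-0 (wordsUpTo L)))
Θ-coeff L ((c , v) ∷ p) (v≤L ∷ p≤L) N = sym (begin
  sumℤ (map (λ u → Θᵤ ((if eqWord v u then c else + 0) +ℤ coeff p u) u) W)
    ≡⟨ sumℤ-map-cong W split ⟩
  sumℤ (map (λ u → (if eqWord v u then Θᵤ c u else + 0) +ℤ Θᵤ (coeff p u) u) W)
    ≡⟨ sumℤ-map-+ (λ u → if eqWord v u then Θᵤ c u else + 0) (λ u → Θᵤ (coeff p u) u) W ⟩
  sumℤ (map (λ u → if eqWord v u then Θᵤ c u else + 0) W) +ℤ sumℤ (map (λ u → Θᵤ (coeff p u) u) W)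
    ≡⟨ cong₂ _+ℤ_ (sum-wordsUpTo-select L v (Θᵤ c)) (sym (Θ-coeff L p p≤L N)) ⟩
  (if length v ≤ᵇ L then Θᵤ c v else + 0) +ℤ Θ p N
    ≡⟨ cong (λ b → (if b then Θᵤ c v else + 0) +ℤ Θ p N) (Equivalence.to Bool.T-≡ (ℕ.≤⇒≤ᵇ v≤L)) ⟩
  Θᵤ c v +ℤ Θ p N
    ∎)
  where
  open ≡-Reasoning
  W = wordsUpTo L
  Θᵤ : ℤ → Word → ℤ
  Θᵤ c u = monomial c (majWeight u) N
  split : ∀ u → Θᵤ ((if eqWord v u then c else + 0) +ℤ coeff p u) u
              ≡ (if eqWord v u then Θᵤ c u else + 0) +ℤ Θᵤ (coeff p u) u
  split u = trans (monomial-+ _ (coeff p u) (majWeight u) N)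
                  (cong (_+ℤ Θᵤ (coeff p u) u) (Bool.if-swap-then (majWeight u ≡ᵇ N) (eqWord v u)))

Θ-cong : ∀ p r → p ≈P r → Θ p ≐ Θ r
Θ-cong p r p≈r N = begin
  Θ p N
    ≡⟨ Θ-coeff L p (LengthsAtMost-mono p (ℕ.m≤m⊔n (maxLength p) (maxLength r)) (LengthsAtMost-maxLength p)) N ⟩
  sumℤ (map (λ u → monomial (coeff p u) (majWeight u) N) (wordsUpTo L))
    ≡⟨ sumℤ-map-cong (wordsUpTo L) (λ u → cong (λ c → monomial c (majWeight u) N) (p≈r u)) ⟩
  sumℤ (map (λ u → monomial (coeff r u) (majWeight u) N) (wordsUpTo L))
    ≡⟨ Θ-coeff L r (LengthsAtMost-mono r (ℕ.m≤n⊔m (maxLength p) (maxLength r)) (LengthsAtMost-maxLength r)) N ⟨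
  Θ r N
    ∎
  where
  open ≡-Reasoning
  L = maxLength p ⊔ maxLength r

Positive : List ℕ → Set
Positive = All (0 <_)

private
  ΘFrom-block-⊗ : ∀ i a r →
    ΘFrom i ((powP 𝐜 a ⊗ 𝐛) ⊗ r) ≐ ΘFrom i (powP 𝐜 a ⊗ 𝐛) ⊛ ΘFrom (i + (a + 1)) r
  ΘFrom-block-⊗ i a r =
    ΘFrom-⊗ i (powP 𝐜 a ⊗ 𝐛) r (OfDegree-⊗ (powP 𝐜 a) 𝐛 (OfDegree-powP𝐜 a) (refl ∷ []))

  ΘFrom-block : ∀ i a → ΘFrom i (powP 𝐜 a ⊗ 𝐛) ≐ pochhammer i a ⊛ qPow (i + a)
  ΘFrom-block i a =
    ≐-trans (ΘFrom-⊗ i (powP 𝐜 a) 𝐛 (OfDegree-powP𝐜 a)) (⊛-cong (ΘFrom-powP𝐜 i a) (ΘFrom-𝐛 (i + a)))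

-- v_(α,b) = v_α b (a-b)^(b-1), and this new b sits at position i + deg v_α.
ΘFrom-vα-∷ʳ : ∀ i a α b → Positive α →
  ΘFrom i (vα ((suc a ∷ α) ∷ʳ b)) ≐
    ΘFrom i (vα (suc a ∷ α)) ⊛ qPow (i + (a + sum α)) ⊛ pochhammer (suc (i + (a + sum α))) (b ∸ 1)
ΘFrom-vα-∷ʳ i a [] b [] = begin
  ΘFrom i ((powP 𝐜 a ⊗ 𝐛) ⊗ powP 𝐜 (b ∸ 1))
    ≈⟨ ΘFrom-block-⊗ i a (powP 𝐜 (b ∸ 1)) ⟩
  ΘFrom i (powP 𝐜 a ⊗ 𝐛) ⊛ ΘFrom (i + (a + 1)) (powP 𝐜 (b ∸ 1))
    ≈⟨ ⊛-cong (ΘFrom-block i a) (ΘFrom-powP𝐜 (i + (a + 1)) (b ∸ 1)) ⟩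
  pochhammer i a ⊛ qPow (i + a) ⊛ pochhammer (i + (a + 1)) (b ∸ 1)
    ≈⟨ ⊛-congʳ (pochhammer (i + (a + 1)) (b ∸ 1)) (⊛-congʳ (qPow (i + a)) (ΘFrom-powP𝐜 i a)) ⟨
  ΘFrom i (powP 𝐜 a) ⊛ qPow (i + a) ⊛ pochhammer (i + (a + 1)) (b ∸ 1)
    ≡⟨ cong₂ (λ k l → ΘFrom i (powP 𝐜 a) ⊛ qPow k ⊛ pochhammer l (b ∸ 1)) (indexₗ i a) (indexᵣ i a) ⟩
  ΘFrom i (powP 𝐜 a) ⊛ qPow (i + (a + 0)) ⊛ pochhammer (suc (i + (a + 0))) (b ∸ 1)
    ∎
  where
  open ≐-Reasoning
  indexₗ : ∀ i a → i + a ≡ i + (a + 0)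
  indexₗ = solve-∀ℕ
  indexᵣ : ∀ i a → i + (a + 1) ≡ suc (i + (a + 0))
  indexᵣ = solve-∀ℕ
ΘFrom-vα-∷ʳ i a (suc c ∷ α) b (z<s ∷ α⁺) = begin
  ΘFrom i ((powP 𝐜 a ⊗ 𝐛) ⊗ vα ((suc c ∷ α) ∷ʳ b))
    ≈⟨ ΘFrom-block-⊗ i a (vα ((suc c ∷ α) ∷ʳ b)) ⟩
  B ⊛ ΘFrom j (vα ((suc c ∷ α) ∷ʳ b))
    ≈⟨ ⊛-congˡ B (ΘFrom-vα-∷ʳ j c α b α⁺) ⟩
  B ⊛ (V ⊛ qPow (j + (c + sum α)) ⊛ P (j + (c + sum α)))
    ≈⟨ ⊛-assoc B (V ⊛ qPow (j + (c + sum α))) (P (j + (c + sum α))) ⟨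
  B ⊛ (V ⊛ qPow (j + (c + sum α))) ⊛ P (j + (c + sum α))
    ≈⟨ ⊛-congʳ (P (j + (c + sum α))) (⊛-assoc B V (qPow (j + (c + sum α)))) ⟨
  B ⊛ V ⊛ qPow (j + (c + sum α)) ⊛ P (j + (c + sum α))
    ≈⟨ ⊛-congʳ (P (j + (c + sum α))) (⊛-congʳ (qPow (j + (c + sum α))) (ΘFrom-block-⊗ i a (vα (suc c ∷ α)))) ⟨
  ΘFrom i (vα (suc a ∷ suc c ∷ α)) ⊛ qPow (j + (c + sum α)) ⊛ P (j + (c + sum α))
    ≡⟨ cong (λ k → ΘFrom i (vα (suc a ∷ suc c ∷ α)) ⊛ qPow k ⊛ P k) (index i a c (sum α)) ⟩
  ΘFrom i (vα (suc a ∷ suc c ∷ α)) ⊛ qPow (i + (a + sum (suc c ∷ α))) ⊛ P (i + (a + sum (suc c ∷ α)))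
    ∎
  where
  open ≐-Reasoning
  j = i + (a + 1)
  B = ΘFrom i (powP 𝐜 a ⊗ 𝐛)
  V = ΘFrom j (vα (suc c ∷ α))
  P : ℕ → Series
  P k = pochhammer (suc k) (b ∸ 1)
  index : ∀ i a c s → i + (a + 1) + (c + s) ≡ i + (a + suc (c + s))
  index = solve-∀ℕ

ΘFrom1-vα-∷ʳ : ∀ α b → Positive α →
  ΘFrom 1 (vα (α ∷ʳ b)) ≐ ΘFrom 1 (vα α) ⊛ qPow (sum α) ⊛ pochhammer (suc (sum α)) (b ∸ 1)
ΘFrom1-vα-∷ʳ []          b []         = begin
  ΘFrom 1 (powP 𝐜 (b ∸ 1))
    ≈⟨ ΘFrom-powP𝐜 1 (b ∸ 1) ⟩
  pochhammer 1 (b ∸ 1)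
    ≈⟨ ⊛-identityˡ (pochhammer 1 (b ∸ 1)) ⟨
  oneS ⊛ pochhammer 1 (b ∸ 1)
    ≈⟨ ⊛-congʳ (pochhammer 1 (b ∸ 1)) (≐-trans (⊛-congʳ (qPow 0) (ΘFrom-oneP 1)) (⊛-identityˡ (qPow 0))) ⟨
  ΘFrom 1 oneP ⊛ qPow 0 ⊛ pochhammer 1 (b ∸ 1)
    ∎
  where open ≐-Reasoning
ΘFrom1-vα-∷ʳ (suc a ∷ α) b (z<s ∷ α⁺) = ΘFrom-vα-∷ʳ 1 a α b α⁺

-- shiftℕ k g = q^k g for ℕ-valued series, in the form in which psCount is written
shiftℕ : ℕ → (ℕ → ℕ) → ℕ → ℕ
shiftℕ k g N = if k ≤ᵇ N then g (N ∸ k) else 0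

shiftℕ-suc : ∀ k g N → shiftℕ (suc k) g (suc N) ≡ shiftℕ k g N
shiftℕ-suc zero    g N = refl
shiftℕ-suc (suc k) g N = refl

shiftℕ-shiftℕ : ∀ k l g N → shiftℕ k (shiftℕ l g) N ≡ shiftℕ (k + l) g N
shiftℕ-shiftℕ zero    l g N       = refl
shiftℕ-shiftℕ (suc k) l g zero    = refl
shiftℕ-shiftℕ (suc k) l g (suc N) =
  trans (shiftℕ-suc k (shiftℕ l g) N) (trans (shiftℕ-shiftℕ k l g N) (sym (shiftℕ-suc (k + l) g N)))

shiftℕ-congBelow : ∀ k {g h} N → (∀ M → M ≤ N → g M ≡ h M) → shiftℕ k g N ≡ shiftℕ k h N
shiftℕ-congBelow k N g≡h with k ≤ᵇ N
... | true  = g≡h (N ∸ k) (ℕ.m∸n≤m N k)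
... | false = refl

shiftℕ-beyond : ∀ k g N → N < k → shiftℕ k g N ≡ 0
shiftℕ-beyond k g N N<k with k ≤ᵇ N | ℕ.≤ᵇ⇒≤ k N
... | true  | k≤N = ⊥-elim (ℕ.<⇒≱ N<k (k≤N _))
... | false | _   = refl

shift-shiftℕ : ∀ k g → shift k (λ M → + g M) ≐ (λ N → + shiftℕ k g N)
shift-shiftℕ zero    g N       = refl
shift-shiftℕ (suc k) g zero    = refl
shift-shiftℕ (suc k) g (suc N) = trans (shift-shiftℕ k g N) (cong +_ (sym (shiftℕ-suc k g N)))

sumBelow : ℕ → (ℕ → ℕ) → ℕ
sumBelow k h = sum (applyUpTo h k)

sumBelow-+ : ∀ k l h → sumBelow (k + l) h ≡ sumBelow k h + sumBelow l (λ j → h (k + j))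
sumBelow-+ zero    l h = refl
sumBelow-+ (suc k) l h = trans (cong (λ n → h 0 + n) (sumBelow-+ k l (h ∘ suc))) (sym (ℕ.+-assoc (h 0) _ _))

sumBelow-cong : ∀ k {h h′} → (∀ j → h j ≡ h′ j) → sumBelow k h ≡ sumBelow k h′
sumBelow-cong zero    h≡h′ = refl
sumBelow-cong (suc k) h≡h′ = cong₂ _+_ (h≡h′ 0) (sumBelow-cong k (h≡h′ ∘ suc))

sumBelow-zero : ∀ k h → (∀ j → h j ≡ 0) → sumBelow k h ≡ 0
sumBelow-zero zero    h h≡0 = refl
sumBelow-zero (suc k) h h≡0 = cong₂ _+_ (h≡0 0) (sumBelow-zero k (h ∘ suc) (h≡0 ∘ suc))

shiftℕ-sumBelow : ∀ k K (h : ℕ → ℕ → ℕ) N →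
  shiftℕ k (λ M → sumBelow K (h M)) N ≡ sumBelow K (λ j → shiftℕ k (λ M → h M j) N)
shiftℕ-sumBelow k K h N with k ≤ᵇ N
... | true  = refl
... | false = sym (sumBelow-zero K (λ _ → 0) (λ _ → refl))

-- the terms of psCount (b ∷ γ) with smallest exponent e₁ = i
psTerm : ℕ → List ℕ → ℕ → ℕ → ℕ
psTerm b γ N i = shiftℕ (b * i) (psCount γ (suc i)) N

psCount-∷ : ∀ b γ lo N → psCount (b ∷ γ) lo N ≡ sumBelow (suc N ∸ lo) (λ j → psTerm b γ N (lo + j))
psCount-∷ b γ lo N = cong sum (trans (sym (List.map-∘ (upTo (suc N ∸ lo)))) (List.map-upTo _ (suc N ∸ lo)))

-- The range of e₁ in psCount may be taken as long as we like: terms with e₁ > N vanish.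
psCount-∷-upTo : ∀ b γ lo N K → 0 < b → suc N ∸ lo ≤ K →
  psCount (b ∷ γ) lo N ≡ sumBelow K (λ j → psTerm b γ N (lo + j))
psCount-∷-upTo (suc b) γ lo N K _ r≤K = begin
  psCount (suc b ∷ γ) lo N
    ≡⟨ psCount-∷ (suc b) γ lo N ⟩
  sumBelow r h
    ≡⟨ ℕ.+-identityʳ _ ⟨
  sumBelow r h + 0
    ≡⟨ cong (λ n → sumBelow r h + n) (sumBelow-zero (K ∸ r) _ beyond) ⟨
  sumBelow r h + sumBelow (K ∸ r) (λ j → h (r + j))
    ≡⟨ sumBelow-+ r (K ∸ r) h ⟨
  sumBelow (r + (K ∸ r)) h
    ≡⟨ cong (λ k → sumBelow k h) (ℕ.m+[n∸m]≡n r≤K) ⟩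
  sumBelow K h
    ∎
  where
  open ≡-Reasoning
  r = suc N ∸ lo
  h = λ j → psTerm (suc b) γ N (lo + j)
  beyond : ∀ j → h (r + j) ≡ 0
  beyond j = shiftℕ-beyond (suc b * i) (psCount γ (suc i)) N (ℕ.≤-trans N<i (ℕ.m≤n*m i (suc b)))
    where
    i = lo + (r + j)
    N<i : N < i
    N<i = ℕ.≤-trans (ℕ.m≤n+m∸n (suc N) lo) (ℕ.≤-trans (ℕ.m≤m+n (lo + r) j) (ℕ.≤-reflexive (ℕ.+-assoc lo r j)))

-- Raising every exponent eⱼ by one multiplies by q^(Σγ).
psCount-suc : ∀ γ → Positive γ → ∀ lo N → psCount γ (suc lo) N ≡ shiftℕ (sum γ) (psCount γ lo) N
psCount-suc []      []          lo N = refl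
psCount-suc (b ∷ γ) (0<b ∷ γ⁺) lo N = begin
  psCount (b ∷ γ) (suc lo) N
    ≡⟨ psCount-∷-upTo b γ (suc lo) N (suc N) 0<b (ℕ.≤-trans (ℕ.m∸n≤m N lo) (ℕ.n≤1+n N)) ⟩
  sumBelow (suc N) (λ j → psTerm b γ N (suc lo + j))
    ≡⟨ sumBelow-cong (suc N) (λ j → psTerm-suc (lo + j)) ⟩
  sumBelow (suc N) (λ j → shiftℕ n (λ M → psTerm b γ M (lo + j)) N)
    ≡⟨ shiftℕ-sumBelow n (suc N) (λ M j → psTerm b γ M (lo + j)) N ⟨
  shiftℕ n (λ M → sumBelow (suc N) (λ j → psTerm b γ M (lo + j))) N
    ≡⟨ shiftℕ-congBelow n N (λ M M≤N →
         sym (psCount-∷-upTo b γ lo M (suc N) 0<b (ℕ.≤-trans (ℕ.m∸n≤m (suc M) lo) (ℕ.s≤s M≤N)))) ⟩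
  shiftℕ n (psCount (b ∷ γ) lo) N
    ∎
  where
  open ≡-Reasoning
  n = b + sum γ
  psTerm-suc : ∀ i → psTerm b γ N (suc i) ≡ shiftℕ n (λ M → psTerm b γ M i) N
  psTerm-suc i = begin
    shiftℕ (b * suc i) (psCount γ (suc (suc i))) N
      ≡⟨ shiftℕ-congBelow (b * suc i) N (λ M _ → psCount-suc γ γ⁺ (suc i) M) ⟩
    shiftℕ (b * suc i) (shiftℕ (sum γ) (psCount γ (suc i))) N
      ≡⟨ shiftℕ-shiftℕ (b * suc i) (sum γ) (psCount γ (suc i)) N ⟩
    shiftℕ (b * suc i + sum γ) (psCount γ (suc i)) N
      ≡⟨ cong (λ k → shiftℕ k (psCount γ (suc i)) N) (exponent b i (sum γ)) ⟩
    shiftℕ (n + b * i) (psCount γ (suc i)) N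
      ≡⟨ shiftℕ-shiftℕ n (b * i) (psCount γ (suc i)) N ⟨
    shiftℕ n (shiftℕ (b * i) (psCount γ (suc i))) N
      ∎
    where
    exponent : ∀ b i s → b * suc i + s ≡ b + s + b * i
    exponent = solve-∀ℕ

-- Split on whether e₁ = 0; the terms with e₁ ≥ 1 are those of psCount (b ∷ γ) 1.
psCount-recurrence : ∀ b γ → Positive (b ∷ γ) → ∀ N →
  psCount (b ∷ γ) 0 N ≡ shiftℕ (sum γ) (psCount γ 0) N + shiftℕ (b + sum γ) (psCount (b ∷ γ) 0) N
psCount-recurrence b γ (0<b ∷ γ⁺) N = begin
  psCount (b ∷ γ) 0 N
    ≡⟨ psCount-∷ b γ 0 N ⟩
  psTerm b γ N 0 + sumBelow N (λ j → psTerm b γ N (suc j))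
    ≡⟨ cong₂ _+_ e₁≡0 (sym (psCount-∷ b γ 1 N)) ⟩
  psCount γ 1 N + psCount (b ∷ γ) 1 N
    ≡⟨ cong₂ _+_ (psCount-suc γ γ⁺ 0 N) (psCount-suc (b ∷ γ) (0<b ∷ γ⁺) 0 N) ⟩
  shiftℕ (sum γ) (psCount γ 0) N + shiftℕ (b + sum γ) (psCount (b ∷ γ) 0) N
    ∎
  where
  open ≡-Reasoning
  e₁≡0 : psTerm b γ N 0 ≡ psCount γ 1 N
  e₁≡0 = cong (λ k → shiftℕ k (psCount γ 1) N) (ℕ.*-zeroʳ b)

oneMinusQPow-⊛-psM : ∀ b γ → Positive (b ∷ γ) →
  oneMinusQPow (sum (b ∷ γ)) ⊛ psM (b ∷ γ) ≐ shift (sum γ) (psM γ)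
oneMinusQPow-⊛-psM b γ β⁺ N = begin
  (oneMinusQPow n ⊛ psM (b ∷ γ)) N
    ≡⟨ oneMinusQPow-⊛ n (psM (b ∷ γ)) N ⟩
  + psCount (b ∷ γ) 0 N +ℤ - shift n (psM (b ∷ γ)) N
    ≡⟨ cong₂ (λ x y → + x +ℤ - y) (psCount-recurrence b γ β⁺ N) (shift-shiftℕ n (λ M → psCount (b ∷ γ) 0 M) N) ⟩
  + (A + B) +ℤ - + B
    ≡⟨ cong (_+ℤ - + B) (ℤ.pos-+ A B) ⟩
  + A +ℤ + B +ℤ - + B
    ≡⟨ cancel (+ A) (+ B) ⟩
  + A
    ≡⟨ shift-shiftℕ (sum γ) (λ M → psCount γ 0 M) N ⟨
  shift (sum γ) (psM γ) N
    ∎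
  where
  open ≡-Reasoning
  n = sum (b ∷ γ)
  A = shiftℕ (sum γ) (psCount γ 0) N
  B = shiftℕ n (psCount (b ∷ γ) 0) N
  cancel : ∀ x y → x +ℤ y +ℤ - y ≡ x
  cancel = solve-∀

psM-[] : psM [] ≐ oneS
psM-[] zero    = refl
psM-[] (suc N) = refl

pochhammer-⊛-psM-∷ : ∀ b γ → Positive (suc b ∷ γ) →
  pochhammer 1 (sum γ + suc b) ⊛ psM (suc b ∷ γ) ≐
    pochhammer 1 (sum γ) ⊛ psM γ ⊛ qPow (sum γ) ⊛ pochhammer (suc (sum γ)) b
pochhammer-⊛-psM-∷ b γ β⁺ = begin
  pochhammer 1 (n + suc b) ⊛ psM β
    ≈⟨ ⊛-congʳ (psM β) (pochhammer-+ 1 n (suc b)) ⟩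
  pochhammer 1 n ⊛ pochhammer (suc n) (suc b) ⊛ psM β
    ≈⟨ ⊛-congʳ (psM β) (⊛-congˡ (pochhammer 1 n) (pochhammer-suc (suc n) b)) ⟩
  pochhammer 1 n ⊛ (P ⊛ oneMinusQPow (suc n + b)) ⊛ psM β
    ≈⟨ ⊛-assoc (pochhammer 1 n) (P ⊛ oneMinusQPow (suc n + b)) (psM β) ⟩
  pochhammer 1 n ⊛ (P ⊛ oneMinusQPow (suc n + b) ⊛ psM β)
    ≈⟨ ⊛-congˡ (pochhammer 1 n) (⊛-assoc P (oneMinusQPow (suc n + b)) (psM β)) ⟩
  pochhammer 1 n ⊛ (P ⊛ (oneMinusQPow (suc n + b) ⊛ psM β))
    ≡⟨ cong (λ k → pochhammer 1 n ⊛ (P ⊛ (oneMinusQPow (suc k) ⊛ psM β))) (ℕ.+-comm n b) ⟩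
  pochhammer 1 n ⊛ (P ⊛ (oneMinusQPow (sum β) ⊛ psM β))
    ≈⟨ ⊛-congˡ (pochhammer 1 n) (⊛-congˡ P (oneMinusQPow-⊛-psM (suc b) γ β⁺)) ⟩
  pochhammer 1 n ⊛ (P ⊛ shift n (psM γ))
    ≈⟨ ⊛-congˡ (pochhammer 1 n) (⊛-congˡ P (qPow-⊛ n (psM γ))) ⟨
  pochhammer 1 n ⊛ (P ⊛ (qPow n ⊛ psM γ))
    ≈⟨ ⊛-congˡ (pochhammer 1 n) (xy∙z≈z∙yx (psM γ) (qPow n) P) ⟨
  pochhammer 1 n ⊛ (psM γ ⊛ qPow n ⊛ P)
    ≈⟨ ⊛-assoc (pochhammer 1 n) (psM γ ⊛ qPow n) P ⟨
  pochhammer 1 n ⊛ (psM γ ⊛ qPow n) ⊛ P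
    ≈⟨ ⊛-congʳ P (⊛-assoc (pochhammer 1 n) (psM γ) (qPow n)) ⟨
  pochhammer 1 n ⊛ psM γ ⊛ qPow n ⊛ P
    ∎
  where
  open ≐-Reasoning
  β = suc b ∷ γ
  n = sum γ
  P = pochhammer (suc n) b

-- Induction on the last part of α, which is the first part of α*.
ΘFrom1-vα : ∀ α → Positive α → ΘFrom 1 (vα α) ≐ pochhammer 1 (sum α) ⊛ psM (reverse α)
ΘFrom1-vα α = go (reverseView α)
  where
  go : ∀ {α} → Reverse α → Positive α → ΘFrom 1 (vα α) ≐ pochhammer 1 (sum α) ⊛ psM (reverse α)
  go [] [] = ≐-trans (ΘFrom-oneP 1) (≐-sym (≐-trans (⊛-identityˡ (psM [])) psM-[]))
  go (xs ∶ xs-view ∶ʳ _) α⁺ with All.∷ʳ⁻ α⁺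
  ... | xs⁺ , z<s {n = b} = begin
    ΘFrom 1 (vα (xs ∷ʳ suc b))
      ≈⟨ ΘFrom1-vα-∷ʳ xs (suc b) xs⁺ ⟩
    ΘFrom 1 (vα xs) ⊛ qPow (sum xs) ⊛ pochhammer (suc (sum xs)) b
      ≈⟨ ⊛-congʳ (pochhammer (suc (sum xs)) b) (⊛-congʳ (qPow (sum xs)) (go xs-view xs⁺)) ⟩
    pochhammer 1 (sum xs) ⊛ psM γ ⊛ qPow (sum xs) ⊛ pochhammer (suc (sum xs)) b
      ≡⟨ cong (λ n → pochhammer 1 n ⊛ psM γ ⊛ qPow n ⊛ pochhammer (suc n) b) sum-γ ⟨
    pochhammer 1 (sum γ) ⊛ psM γ ⊛ qPow (sum γ) ⊛ pochhammer (suc (sum γ)) b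
      ≈⟨ pochhammer-⊛-psM-∷ b γ (z<s ∷ All-resp-↭ (↭-sym (↭-reverse xs)) xs⁺) ⟨
    pochhammer 1 (sum γ + suc b) ⊛ psM (suc b ∷ γ)
      ≡⟨ cong₂ (λ k δ → pochhammer 1 k ⊛ psM δ) sum-∷ʳ (sym (List.reverse-++ xs (suc b ∷ []))) ⟩
    pochhammer 1 (sum (xs ∷ʳ suc b)) ⊛ psM (reverse (xs ∷ʳ suc b))
      ∎
    where
    open ≐-Reasoning
    γ = reverse xs
    sum-γ : sum γ ≡ sum xs
    sum-γ = Sum.sum-↭ (↭-reverse xs)
    sum-∷ʳ : sum γ + suc b ≡ sum (xs ∷ʳ suc b)
    sum-∷ʳ = trans (cong (_+ suc b) sum-γ)
                   (sym (trans (Sum.sum-++ xs (suc b ∷ [])) (cong (λ k → sum xs + k) (ℕ.+-identityʳ (suc b)))))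

compFrom-positive : ∀ {m} acc (S : Vec Bool m) → 0 < acc → Positive (compFrom acc S)
compFrom-positive acc []          0<acc = 0<acc ∷ []
compFrom-positive acc (true ∷ S)  0<acc = 0<acc ∷ compFrom-positive 1 S z<s
compFrom-positive acc (false ∷ S) 0<acc = compFrom-positive (suc acc) S z<s

compFrom-sum : ∀ {m} acc (S : Vec Bool m) → sum (compFrom acc S) ≡ acc + m
compFrom-sum acc []          = refl
compFrom-sum acc (true ∷ S)  = cong (λ k → acc + k) (compFrom-sum 1 S)
compFrom-sum acc (false ∷ S) = trans (compFrom-sum (suc acc) S) (sym (ℕ.+-suc acc _))

Θ-ΣvBasis : ∀ m c → Θ (ΣvBasis m c) ≐ pochhammer 1 (suc m) ⊛ psStarγ m c
Θ-ΣvBasis m c = go (allVec m)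
  where
  term : Vec Bool m → NCPoly
  term S = scale (c S) (vα (comp S))
  psTerms : List (Vec Bool m) → Series
  psTerms Ss N = sumℤ (map (λ S → c S *ℤ psM (reverse (comp S)) N) Ss)
  go : ∀ Ss → ΘFrom 1 (concatMap term Ss) ≐ pochhammer 1 (suc m) ⊛ psTerms Ss
  go []       = ≐-sym (SeriesRing.zeroʳ (pochhammer 1 (suc m)))
  go (S ∷ Ss) = begin
    ΘFrom 1 (term S ++ concatMap term Ss)
      ≈⟨ ΘFrom-++ 1 (term S) (concatMap term Ss) ⟩
    ΘFrom 1 (term S) +ˢ ΘFrom 1 (concatMap term Ss)
      ≈⟨ SeriesRing.+-cong (ΘFrom-scale 1 (c S) (vα (comp S))) (go Ss) ⟩
    c S ·ˢ ΘFrom 1 (vα (comp S)) +ˢ X ⊛ psTerms Ss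
      ≈⟨ SeriesRing.+-congʳ (λ N → cong (c S *ℤ_) (v-comp N)) ⟩
    c S ·ˢ (X ⊛ psM (reverse (comp S))) +ˢ X ⊛ psTerms Ss
      ≈⟨ SeriesRing.+-congʳ (⊛-scaleʳ (c S) X (psM (reverse (comp S)))) ⟨
    X ⊛ (c S ·ˢ psM (reverse (comp S))) +ˢ X ⊛ psTerms Ss
      ≈⟨ SeriesRing.distribˡ X (c S ·ˢ psM (reverse (comp S))) (psTerms Ss) ⟨
    X ⊛ psTerms (S ∷ Ss)
      ∎
    where
    open ≐-Reasoning
    X = pochhammer 1 (suc m)
    v-comp : ΘFrom 1 (vα (comp S)) ≐ X ⊛ psM (reverse (comp S))
    v-comp = ≐-trans (ΘFrom1-vα (comp S) (compFrom-positive 1 S z<s))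
                     (⊛-congʳ (psM (reverse (comp S))) (≐-reflexive (cong (pochhammer 1) (compFrom-sum 1 S))))

Θ-ΣvBasis-qfact : ∀ m c → Θ (ΣvBasis m c) ≐ powS oneMinusQ (suc m) ⊛ qfact (suc m) ⊛ psStarγ m c
Θ-ΣvBasis-qfact m c =
  ≐-trans (Θ-ΣvBasis m c) (⊛-congʳ (psStarγ m c) (≐-sym (qfact-pochhammer (suc m))))

mainTheorem6 : ((m : ℕ) (w : NCPoly) → Homogeneous m w →
    (c : Vec Bool m → ℤ) → w ≈P ΣvBasis m c →
    ∀ N → Θ w N ≡ (powS oneMinusQ (suc m) ⊛ qfact (suc m) ⊛ psStarγ m c) N)
    ×
    ((m : ℕ) (P : GradedPoset (suc m)) →
    (c : Vec Bool m → ℤ) → Ψ P ≈P ΣvBasis m c →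
    ∀ N → Θ (Ψ P) N ≡ (powS oneMinusQ (suc m) ⊛ qfact (suc m) ⊛ psStarγ m c) N)
mainTheorem6 =
  (λ m w _ c w≈ → ≐-trans (Θ-cong w (ΣvBasis m c) w≈) (Θ-ΣvBasis-qfact m c)) ,
  (λ m P c Ψ≈ → ≐-trans (Θ-cong (Ψ P) (ΣvBasis m c) Ψ≈) (Θ-ΣvBasis-qfact m c))
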